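{- If $R$ is an Ore-collapsible subset of a graph $G$, then there exists a diamond or an emerald of $G$ all of whose vertices lie in $R$.
   Context: All graphs are finite and simple. An Ore-composition of $G_1$ and $G_2$: delete an edge $xy$ of $G_1$, split a vertex $z$ of $G_2$ into two vertices $z_1,z_2$ of positive degree, identify $x$ with $z_1$ and $y$ with $z_2$. A graph is $5$-Ore if obtainable from copies of $K_5$ by repeated Ore-compositions. A diamond in $G$ is a subgraph isomorphic to $K_5-e$ in which the three vertices not incident to the missing edge $e$ have degree four in $G$. An emerald in $G$ is a subgraph isomorphic to $K_4$ all of whose vertices have degree four in $G$. The boundary of $R\subseteq V(G)$ is the set of vertices of $R$ with a neighbor outside $R$. An Ore-collapsible subset of $V(G)$ is a proper subset $R$ whose boundary consists of exactly two non-adjacent vertices $u,v$ such that $G[R]+uv$ is $5$-Ore. -}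

module Defs where

open import Data.Nat using (ℕ)
open import Data.Fin using (Fin; zero; suc)
open import Data.Fin.Subset using (Subset; _∈_; _∉_)
open import Data.Bool using (Bool; true; false)
open import Data.List using (List; length; filter)
open import Data.List using () renaming (allFin to allFinL)
open import Data.Product using (Σ; ∃; ∃-syntax; _×_; _,_)
open import Data.Sum using (_⊎_)
open import Relation.Nullary using (¬_; Dec)
open import Relation.Binary.PropositionalEquality using (_≡_; _≢_)

_⟺_ : Set → Set → Set
A ⟺ B = (A → B) × (B → A)
infix 3 _⟺_

record Graph (n : ℕ) : Set₁ where
  field
    Adj    : Fin n → Fin n → Set
    sym    : ∀ {u v} → Adj u v → Adj v u
    irrefl : ∀ {u} → ¬ Adj u u
    dec    : ∀ u v → Dec (Adj u v)
open Graph public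

deg : ∀ {n} → Graph n → Fin n → ℕ
deg {n} G v = length (filter (λ u → dec G v u) (allFinL n))

Injective : ∀ {m n} → (Fin m → Fin n) → Set
Injective f = ∀ a b → f a ≡ f b → a ≡ b

-- G is an Ore-composition of G₁ and G₂ (up to isomorphism):
-- delete the edge xy of G₁, split z of G₂ into z₁ (neighbours w with
-- side w ≡ true) and z₂ (neighbours with side w ≡ false), both of
-- positive degree, identify x with z₁ and y with z₂.
-- φ embeds V(G₁) into V(G); ψ embeds V(G₂) ∖ {z} into V(G).
record OreComposition {n₁ n₂ n : ℕ} (G₁ : Graph n₁) (G₂ : Graph n₂) (G : Graph n) : Set where
  field
    x y   : Fin n₁
    xy    : Adj G₁ x y
    z     : Fin n₂
    φ     : Fin n₁ → Fin n
    ψ     : Fin n₂ → Fin n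
    φ-inj : Injective φ
    ψ-inj : ∀ a b → a ≢ z → b ≢ z → ψ a ≡ ψ b → a ≡ b
    disj  : ∀ a b → b ≢ z → φ a ≢ ψ b
    cover : ∀ v → (∃[ a ] φ a ≡ v) ⊎ (∃[ b ] (b ≢ z × ψ b ≡ v))
    side  : Fin n₂ → Bool
    z₁-pos : ∃[ w ] (Adj G₂ z w × side w ≡ true)
    z₂-pos : ∃[ w ] (Adj G₂ z w × side w ≡ false)
    adj   : ∀ u v → Adj G u v ⟺
              ( (∃[ a ] ∃[ b ] (φ a ≡ u × φ b ≡ v × Adj G₁ a b
                                 × ¬ ((a ≡ x × b ≡ y) ⊎ (a ≡ y × b ≡ x))))
              ⊎ (∃[ a ] ∃[ b ] (a ≢ z × b ≢ z × ψ a ≡ u × ψ b ≡ v × Adj G₂ a b))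
              ⊎ (∃[ w ] (Adj G₂ z w ×
                   ( (side w ≡ true  × ((u ≡ φ x × v ≡ ψ w) ⊎ (u ≡ ψ w × v ≡ φ x)))
                   ⊎ (side w ≡ false × ((u ≡ φ y × v ≡ ψ w) ⊎ (u ≡ ψ w × v ≡ φ y)))))))

data Is5Ore : {n : ℕ} → Graph n → Set₁ where
  K5  : ∀ {n} (G : Graph n) → n ≡ 5 → (∀ u v → Adj G u v ⟺ u ≢ v) → Is5Ore G
  ore : ∀ {n₁ n₂ n} {G₁ : Graph n₁} {G₂ : Graph n₂} {G : Graph n} →
        Is5Ore G₁ → Is5Ore G₂ → OreComposition G₁ G₂ G → Is5Ore G

-- Vertices of Fin 5: 0 and 1 are the ends of the missing edge e.
record Diamond {n : ℕ} (G : Graph n) : Set where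
  field
    f     : Fin 5 → Fin n
    f-inj : Injective f
    edges : ∀ i j → i ≢ j → ¬ ((i ≡ zero × j ≡ suc zero) ⊎ (i ≡ suc zero × j ≡ zero))
            → Adj G (f i) (f j)
    deg2  : deg G (f (suc (suc zero))) ≡ 4
    deg3  : deg G (f (suc (suc (suc zero)))) ≡ 4
    deg4  : deg G (f (suc (suc (suc (suc zero))))) ≡ 4

record Emerald {n : ℕ} (G : Graph n) : Set where
  field
    f     : Fin 4 → Fin n
    f-inj : Injective f
    edges : ∀ i j → i ≢ j → Adj G (f i) (f j)
    degs  : ∀ i → deg G (f i) ≡ 4

InBoundary : ∀ {n} → Graph n → Subset n → Fin n → Set
InBoundary G R w = w ∈ R × ∃[ w' ] (w' ∉ R × Adj G w w')

record InducedPlusEdge {n k : ℕ} (G : Graph n) (R : Subset n) (u v : Fin n) (H : Graph k) : Set where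
  field
    ι     : Fin k → Fin n
    ι-inj : Injective ι
    ι-img : ∀ w → w ∈ R ⟺ (∃[ a ] ι a ≡ w)
    adj   : ∀ a b → Adj H a b ⟺
              (Adj G (ι a) (ι b) ⊎ ((ι a ≡ u × ι b ≡ v) ⊎ (ι a ≡ v × ι b ≡ u)))

record OreCollapsible {n : ℕ} (G : Graph n) (R : Subset n) : Set₁ where
  field
    proper   : ∃[ w ] w ∉ R
    u v      : Fin n
    u≢v      : u ≢ v
    nonadj   : ¬ Adj G u v
    boundary : ∀ w → InBoundary G R w ⟺ (w ≡ u ⊎ w ≡ v)
    k        : ℕ
    H        : Graph k
    H-ind    : InducedPlusEdge G R u v H
    H-ore    : Is5Ore H

DiamondIn : ∀ {n} (G : Graph n) → Subset n → Set
DiamondIn G R = Σ (Diamond G) (λ D → ∀ i → Diamond.f D i ∈ R)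

EmeraldIn : ∀ {n} (G : Graph n) → Subset n → Set
EmeraldIn G R = Σ (Emerald G) (λ E → ∀ i → Emerald.f E i ∈ R)

module Submission where

-- Call a diamond or emerald of a graph a gem, and its vertices that are
-- required to have degree four (three for a diamond, all four for an
-- emerald) its core.  We prove by induction on 5-Ore graphs H that
--   (E) for every edge uv of H some gem of H has its core disjoint from {u,v};
--   (V) for every vertex z of H some gem of H avoids z altogether.  For an Ore-composition G of G₁ (edge xy
-- deleted) and G₂ (vertex z split) the gem of G₁ given by (E) at xy and the
-- gem of G₂ given by (V) at z stay gems in G: edges and degrees survive
-- everywhere except at x, y and z.  Every vertex and every edge of G lies on
-- one side of the composition, and the gem coming from the other side does
-- the job.
-- Finally, if R is Ore-collapsible with boundary {u,v}, apply (E) to the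
-- edge uv of H = G[R] + uv: the core of the gem avoids u and v, and vertices
-- of R other than u, v have the same neighbours in H and in G, so the gem is
-- a gem of G inside R.

open import Data.Bool using (Bool; true; false)
open import Data.Empty using (⊥-elim)
open import Data.Fin using (Fin; zero; suc; punchIn; punchOut)
open import Data.Fin.Properties using (_≟_; punchIn-injective; punchInᵢ≢i; punchIn-punchOut)
open import Data.Fin.Subset using (Subset; _∈_)
open import Data.Fin.Subset.Properties using (_∈?_)
open import Data.List using (List; []; _∷_; _++_; length; filter; allFin)
open import Data.List.Properties using (length-++)
open import Data.List.Membership.Propositional using () renaming (_∈_ to _∈ₗ_)
open import Data.List.Membership.Propositional.Properties
  using (∈-∃++; ∈-++⁻; ∈-++⁺ˡ; ∈-++⁺ʳ; ∈-filter⁺; ∈-filter⁻; ∈-allFin)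
open import Data.List.Relation.Unary.Any using (here; there)
open import Data.List.Relation.Unary.All using (lookup)
open import Data.List.Relation.Unary.AllPairs using (_∷_)
open import Data.List.Relation.Unary.Unique.Propositional using (Unique)
open import Data.List.Relation.Unary.Unique.Propositional.Properties using (allFin⁺; filter⁺)
open import Data.Nat using (ℕ; suc; _+_; _≤_; z≤n; s≤s)
open import Data.Nat.Properties using (≤-antisym; +-suc)
open import Data.Product using (Σ; ∃-syntax; _×_; _,_; proj₁; proj₂)
open import Data.Sum using (_⊎_; inj₁; inj₂)
open import Data.Unit using (⊤; tt)
open import Relation.Binary.PropositionalEquality
  using (_≡_; _≢_; refl; sym; trans; cong; subst; module ≡-Reasoning)
open import Relation.Nullary using (¬_; yes; no; ¬?)
open import Defs renaming (sym to adj-sym)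

separated : ∀ {n} (S : Fin n → Set) {s t : Fin n} → ¬ S s → S t → s ≢ t
separated S ¬Ss St refl = ¬Ss St

Avoids : ∀ {n} → Fin n → Fin n → Fin n → Set
Avoids x y t = t ≢ x × t ≢ y

IsPair : ∀ {n} → Fin n → Fin n → Fin n → Fin n → Set
IsPair x y c d = (c ≡ x × d ≡ y) ⊎ (c ≡ y × d ≡ x)

avoids-not-pair : ∀ {n} {x y c d : Fin n} → Avoids x y c ⊎ Avoids x y d → ¬ IsPair x y c d
avoids-not-pair (inj₁ (c≢x , _)) (inj₁ (c≡x , _)) = c≢x c≡x
avoids-not-pair (inj₁ (_ , c≢y)) (inj₂ (c≡y , _)) = c≢y c≡y
avoids-not-pair (inj₂ (_ , d≢y)) (inj₁ (_ , d≡y)) = d≢y d≡y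
avoids-not-pair (inj₂ (d≢x , _)) (inj₂ (_ , d≡x)) = d≢x d≡x

length-middle : ∀ {A : Set} (ys₁ : List A) (y : A) (ys₂ : List A) →
  length (ys₁ ++ y ∷ ys₂) ≡ suc (length (ys₁ ++ ys₂))
length-middle ys₁ y ys₂ = begin
  length (ys₁ ++ y ∷ ys₂)          ≡⟨ length-++ ys₁ ⟩
  length ys₁ + suc (length ys₂)    ≡⟨ +-suc (length ys₁) (length ys₂) ⟩
  suc (length ys₁ + length ys₂)    ≡⟨ cong suc (sym (length-++ ys₁)) ⟩
  suc (length (ys₁ ++ ys₂))        ∎
  where open ≡-Reasoning

length-≤-matching : ∀ {A B : Set} (R : A → B → Set) (xs : List A) (ys : List B) →
  Unique xs →
  (∀ x → x ∈ₗ xs → ∃[ y ] (y ∈ₗ ys × R x y)) →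
  (∀ x x' y → x ∈ₗ xs → x' ∈ₗ xs → R x y → R x' y → x ≡ x') →
  length xs ≤ length ys
length-≤-matching R [] ys _ _ _ = z≤n
length-≤-matching R (x ∷ xs) ys (x∉xs ∷ unique) matched matched-once
  with matched x (here refl)
... | y , y∈ys , Rxy with ∈-∃++ y∈ys
... | ys₁ , ys₂ , refl =
  subst (suc (length xs) ≤_) (sym (length-middle ys₁ y ys₂))
    (s≤s (length-≤-matching R xs (ys₁ ++ ys₂) unique matched-rest
           (λ a b c a∈ b∈ → matched-once a b c (there a∈) (there b∈))))
  where
  -- y is taken by x, so the other elements are matched inside ys₁ ++ ys₂.
  matched-rest : ∀ x' → x' ∈ₗ xs → ∃[ y' ] (y' ∈ₗ (ys₁ ++ ys₂) × R x' y')
  matched-rest x' x'∈ with matched x' (there x'∈)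
  ... | y' , y'∈ , Rx'y' with ∈-++⁻ ys₁ y'∈
  ... | inj₁ y'∈ys₁         = y' , ∈-++⁺ˡ y'∈ys₁ , Rx'y'
  ... | inj₂ (there y'∈ys₂) = y' , ∈-++⁺ʳ ys₁ y'∈ys₂ , Rx'y'
  ... | inj₂ (here refl)    =
    ⊥-elim (lookup x∉xs x'∈ (matched-once x x' y (here refl) (there x'∈) Rxy Rx'y'))

Neighbours : ∀ {m} → Graph m → Fin m → List (Fin m)
Neighbours {m} A a = filter (dec A a) (allFin m)

neighbour⁺ : ∀ {m} (A : Graph m) {a c : Fin m} → Adj A a c → c ∈ₗ Neighbours A a
neighbour⁺ A {c = c} ac = ∈-filter⁺ (dec A _) (∈-allFin c) ac

neighbour⁻ : ∀ {m} (A : Graph m) {a c : Fin m} → c ∈ₗ Neighbours A a → Adj A a c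
neighbour⁻ {m} A c∈ = proj₂ (∈-filter⁻ (dec A _) {xs = allFin m} c∈)

deg-bijection : ∀ {m n} (A : Graph m) (B : Graph n) (a : Fin m) (b : Fin n) (h : Fin m → Fin n) →
  (∀ c → Adj A a c → Adj B b (h c)) →
  (∀ c c' → Adj A a c → Adj A a c' → h c ≡ h c' → c ≡ c') →
  (∀ d → Adj B b d → ∃[ c ] (Adj A a c × h c ≡ d)) →
  deg B b ≡ deg A a
deg-bijection {m} {n} A B a b h into injective onto = ≤-antisym B≤A A≤B
  where
  A≤B : deg A a ≤ deg B b
  A≤B = length-≤-matching (λ c d → h c ≡ d) (Neighbours A a) (Neighbours B b)
    (filter⁺ (dec A a) (allFin⁺ m))
    (λ c c∈ → h c , neighbour⁺ B (into c (neighbour⁻ A c∈)) , refl)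
    (λ c c' d c∈ c'∈ hc hc' → injective c c' (neighbour⁻ A c∈) (neighbour⁻ A c'∈) (trans hc (sym hc')))
  B≤A : deg B b ≤ deg A a
  B≤A = length-≤-matching (λ d c → h c ≡ d) (Neighbours B b) (Neighbours A a)
    (filter⁺ (dec B b) (allFin⁺ n))
    (λ d d∈ → let (c , ac , hc) = onto d (neighbour⁻ B d∈) in c , neighbour⁺ A ac , hc)
    (λ d d' c _ _ hc hc' → trans (sym hc) hc')

-- The core of a diamond: the vertices not on its missing edge 0–1.
d₂ d₃ d₄ : Fin 5
d₂ = suc (suc zero)
d₃ = suc (suc (suc zero))
d₄ = suc (suc (suc (suc zero)))

diamond-edge-meets-core : (Q : Fin 5 → Set) → Q d₂ → Q d₃ → Q d₄ →
  ∀ i j → i ≢ j → ¬ IsPair zero (suc zero) i j → Q i ⊎ Q j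
diamond-edge-meets-core Q q₂ q₃ q₄ (suc (suc zero))                 j _ _ = inj₁ q₂
diamond-edge-meets-core Q q₂ q₃ q₄ (suc (suc (suc zero)))           j _ _ = inj₁ q₃
diamond-edge-meets-core Q q₂ q₃ q₄ (suc (suc (suc (suc zero))))     j _ _ = inj₁ q₄
diamond-edge-meets-core Q q₂ q₃ q₄ i (suc (suc zero))                 _ _ = inj₂ q₂
diamond-edge-meets-core Q q₂ q₃ q₄ i (suc (suc (suc zero)))           _ _ = inj₂ q₃
diamond-edge-meets-core Q q₂ q₃ q₄ i (suc (suc (suc (suc zero))))     _ _ = inj₂ q₄
diamond-edge-meets-core Q q₂ q₃ q₄ zero       zero       i≢j _ = ⊥-elim (i≢j refl)
diamond-edge-meets-core Q q₂ q₃ q₄ zero       (suc zero) _ ¬e  = ⊥-elim (¬e (inj₁ (refl , refl)))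
diamond-edge-meets-core Q q₂ q₃ q₄ (suc zero) zero       _ ¬e  = ⊥-elim (¬e (inj₂ (refl , refl)))
diamond-edge-meets-core Q q₂ q₃ q₄ (suc zero) (suc zero) i≢j _ = ⊥-elim (i≢j refl)

DiamondGem : ∀ {n} (G : Graph n) (P Q : Fin n → Set) → Set
DiamondGem G P Q = Σ (Diamond G) λ D → let open Diamond D in
  (∀ i → P (f i)) × Q (f d₂) × Q (f d₃) × Q (f d₄)

EmeraldGem : ∀ {n} (G : Graph n) (P Q : Fin n → Set) → Set
EmeraldGem G P Q = Σ (Emerald G) λ E → let open Emerald E in ∀ i → P (f i) × Q (f i)

data Gem {n} (G : Graph n) (P Q : Fin n → Set) : Set where
  diamond : DiamondGem G P Q → Gem G P Q
  emerald : EmeraldGem G P Q → Gem G P Q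

-- A map from A to B that is injective on P-vertices, keeps the edges at
-- Q-vertices and keeps the degrees of Q-vertices: gems of A with vertices in
-- P and core in Q are carried to gems of B.
record GemEmbedding {m n} (A : Graph m) (B : Graph n) (P Q : Fin m → Set) : Set where
  field
    map       : Fin m → Fin n
    injective : ∀ c d → P c → P d → map c ≡ map d → c ≡ d
    edges     : ∀ c d → P c → P d → Adj A c d → Q c ⊎ Q d → Adj B (map c) (map d)
    degrees   : ∀ c → P c → Q c → deg B (map c) ≡ deg A c

transport : ∀ {m n} {A : Graph m} {B : Graph n} {P Q : Fin m → Set} {P' Q' : Fin n → Set} →
  (g : GemEmbedding A B P Q) → let open GemEmbedding g in
  (∀ c → P c → P' (map c)) → (∀ c → P c → Q c → Q' (map c)) →
  Gem A P Q → Gem B P' Q'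
transport {Q = Q} g toP toQ (diamond (D , ps , q₂ , q₃ , q₄)) = diamond
  (record { f     = λ i → map (f i)
          ; f-inj = λ i j e → f-inj i j (injective (f i) (f j) (ps i) (ps j) e)
          ; edges = λ i j i≢j ¬e → GemEmbedding.edges g (f i) (f j) (ps i) (ps j)
                      (edges i j i≢j ¬e)
                      (diamond-edge-meets-core (λ k → Q (f k)) q₂ q₃ q₄ i j i≢j ¬e)
          ; deg2  = trans (degrees _ (ps d₂) q₂) deg2
          ; deg3  = trans (degrees _ (ps d₃) q₃) deg3
          ; deg4  = trans (degrees _ (ps d₄) q₄) deg4 }
  , (λ i → toP _ (ps i))
  , toQ _ (ps d₂) q₂ , toQ _ (ps d₃) q₃ , toQ _ (ps d₄) q₄)
  where open GemEmbedding g using (map; injective; degrees)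
        open Diamond D
transport {P = P} {Q = Q} g toP toQ (emerald (E , pq)) = emerald
  (record { f     = λ i → map (f i)
          ; f-inj = λ i j e → f-inj i j (injective (f i) (f j) (ps i) (ps j) e)
          ; edges = λ i j i≢j → GemEmbedding.edges g (f i) (f j) (ps i) (ps j)
                      (edges i j i≢j) (inj₁ (qs i))
          ; degs  = λ i → trans (degrees _ (ps i) (qs i)) (degs i) }
  , λ i → toP _ (ps i) , toQ _ (ps i) (qs i))
  where open GemEmbedding g using (map; injective; degrees)
        open Emerald E
        ps : ∀ i → P (f i)
        ps i = proj₁ (pq i)
        qs : ∀ i → Q (f i)
        qs i = proj₂ (pq i)

EdgeGems : ∀ {n} → Graph n → Set
EdgeGems H = ∀ u v → Adj H u v → Gem H (λ _ → ⊤) (Avoids u v)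

VertexGems : ∀ {n} → Graph n → Set
VertexGems H = ∀ z → Gem H (λ t → t ≢ z) (λ _ → ⊤)

-- The standard complete graph on Fin 5, whose degrees compute.
K₅ : Graph 5
K₅ = record { Adj = λ u v → u ≢ v ; sym = λ u≢v v≡u → u≢v (sym v≡u)
            ; irrefl = λ u≢u → u≢u refl ; dec = λ u v → ¬? (u ≟ v) }

deg-K₅ : ∀ v → deg K₅ v ≡ 4
deg-K₅ zero                         = refl
deg-K₅ (suc zero)                   = refl
deg-K₅ (suc (suc zero))             = refl
deg-K₅ (suc (suc (suc zero)))       = refl
deg-K₅ (suc (suc (suc (suc zero)))) = refl

startAt : ∀ {k} → Fin (suc k) → Fin (suc k) → Fin (suc k)
startAt a zero    = a
startAt a (suc i) = punchIn a i

startAt-injective : ∀ {k} (a : Fin (suc k)) → Injective (startAt a)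
startAt-injective a zero    zero    _ = refl
startAt-injective a zero    (suc j) e = ⊥-elim (punchInᵢ≢i a j (sym e))
startAt-injective a (suc i) zero    e = ⊥-elim (punchInᵢ≢i a i e)
startAt-injective a (suc i) (suc j) e = cong suc (punchIn-injective a i j e)

module CompleteGems (G : Graph 5) (complete : ∀ u v → Adj G u v ⟺ u ≢ v) where

  degree-four : ∀ v → deg G v ≡ 4
  degree-four v = trans
    (deg-bijection K₅ G v v (λ c → c) (λ c v≢c → proj₂ (complete v c) v≢c)
      (λ c c' _ _ c≡c' → c≡c') (λ d vd → d , proj₁ (complete v d) vd , refl))
    (deg-K₅ v)

  clique : ∀ {k} (f : Fin k → Fin 5) → Injective f → ∀ i j → i ≢ j → Adj G (f i) (f j)
  clique f f-inj i j i≢j = proj₂ (complete _ _) (λ e → i≢j (f-inj i j e))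

  -- For an edge uv, list the vertices as u, v, rest: a diamond with core
  -- off {u, v}.
  edge-gems : EdgeGems G
  edge-gems u v uv = diamond
    (record { f = π ; f-inj = π-injective
            ; edges = λ i j i≢j _ → clique π π-injective i j i≢j
            ; deg2 = degree-four _ ; deg3 = degree-four _ ; deg4 = degree-four _ }
    , (λ _ → tt) , off-uv zero , off-uv (suc zero) , off-uv (suc (suc zero)))
    where
    u≢v : u ≢ v
    u≢v = proj₁ (complete u v) uv
    v' : Fin 4
    v' = punchOut u≢v
    π : Fin 5 → Fin 5
    π zero    = u
    π (suc i) = punchIn u (startAt v' i)
    π-injective : Injective π
    π-injective zero    zero    _ = refl
    π-injective zero    (suc j) e = ⊥-elim (punchInᵢ≢i u _ (sym e))
    π-injective (suc i) zero    e = ⊥-elim (punchInᵢ≢i u _ e)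
    π-injective (suc i) (suc j) e =
      cong suc (startAt-injective v' i j (punchIn-injective u _ _ e))
    off-uv : ∀ k → Avoids u v (π (suc (suc k)))
    off-uv k = punchInᵢ≢i u _
             , λ e → punchInᵢ≢i v' k
                       (punchIn-injective u _ _ (trans e (sym (punchIn-punchOut u≢v))))

  -- Removing z leaves an emerald.
  vertex-gems : VertexGems G
  vertex-gems z = emerald
    (record { f = punchIn z ; f-inj = punchIn-injective z
            ; edges = clique (punchIn z) (punchIn-injective z)
            ; degs = λ _ → degree-four _ }
    , λ i → punchInᵢ≢i z i , tt)

module OreGems {n₁ n₂ n} {G₁ : Graph n₁} {G₂ : Graph n₂} {G : Graph n}
               (O : OreComposition G₁ G₂ G) where
  open OreComposition O

  z-neighbour : ∀ {w} → Adj G₂ z w → w ≢ z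
  z-neighbour zw refl = irrefl G₂ zw

  -- Vertices of G coming from G₁, and from G₂ (the two halves of z are
  -- φ x and φ y).
  FromG₁ : Fin n → Set
  FromG₁ s = ∃[ a ] φ a ≡ s

  FromG₂ : Fin n → Set
  FromG₂ s = s ≡ φ x ⊎ s ≡ φ y ⊎ ∃[ w ] (w ≢ z × s ≡ ψ w)

  ψ-not-FromG₁ : ∀ c → c ≢ z → ¬ FromG₁ (ψ c)
  ψ-not-FromG₁ c c≢z (a , φa≡ψc) = disj a c c≢z φa≡ψc

  interior-not-FromG₂ : ∀ c → Avoids x y c → ¬ FromG₂ (φ c)
  interior-not-FromG₂ c (c≢x , _) (inj₁ e)                  = c≢x (φ-inj _ _ e)
  interior-not-FromG₂ c (_ , c≢y) (inj₂ (inj₁ e))           = c≢y (φ-inj _ _ e)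
  interior-not-FromG₂ c _         (inj₂ (inj₂ (w , w≢z , e))) = disj c w w≢z e

  edge-sides : ∀ {u v} → Adj G u v → (FromG₁ u × FromG₁ v) ⊎ (FromG₂ u × FromG₂ v)
  edge-sides uv with proj₁ (adj _ _) uv
  ... | inj₁ (a , b , refl , refl , _) = inj₁ ((a , refl) , (b , refl))
  ... | inj₂ (inj₁ (a , b , a≢z , b≢z , refl , refl , _)) =
    inj₂ (inj₂ (inj₂ (a , a≢z , refl)) , inj₂ (inj₂ (b , b≢z , refl)))
  ... | inj₂ (inj₂ (w , zw , inj₁ (_ , inj₁ (refl , refl)))) =
    inj₂ (inj₁ refl , inj₂ (inj₂ (w , z-neighbour zw , refl)))
  ... | inj₂ (inj₂ (w , zw , inj₁ (_ , inj₂ (refl , refl)))) =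
    inj₂ (inj₂ (inj₂ (w , z-neighbour zw , refl)) , inj₁ refl)
  ... | inj₂ (inj₂ (w , zw , inj₂ (_ , inj₁ (refl , refl)))) =
    inj₂ (inj₂ (inj₁ refl) , inj₂ (inj₂ (w , z-neighbour zw , refl)))
  ... | inj₂ (inj₂ (w , zw , inj₂ (_ , inj₂ (refl , refl)))) =
    inj₂ (inj₂ (inj₂ (w , z-neighbour zw , refl)) , inj₂ (inj₁ refl))

  φ-edge : ∀ a b → Adj G₁ a b → ¬ IsPair x y a b → Adj G (φ a) (φ b)
  φ-edge a b ab ¬xy = proj₂ (adj _ _) (inj₁ (a , b , refl , refl , ab , ¬xy))

  φ-deg : ∀ a → Avoids x y a → deg G (φ a) ≡ deg G₁ a
  φ-deg a a∉xy = deg-bijection G₁ G a (φ a) φ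
    (λ c ac → φ-edge a c ac (avoids-not-pair (inj₁ a∉xy)))
    (λ c c' _ _ → φ-inj c c') onto
    where
    onto : ∀ d → Adj G (φ a) d → ∃[ c ] (Adj G₁ a c × φ c ≡ d)
    onto d e with proj₁ (adj _ _) e
    ... | inj₁ (a' , c , φa'≡φa , φc≡d , a'c , _) with φ-inj a' a φa'≡φa
    ... | refl = c , a'c , φc≡d
    onto d e | inj₂ (inj₁ (a' , _ , a'≢z , _ , ψa'≡φa , _)) = ⊥-elim (disj a a' a'≢z (sym ψa'≡φa))
    onto d e | inj₂ (inj₂ (_ , _ , inj₁ (_ , inj₁ (φa≡φx , _)))) = ⊥-elim (proj₁ a∉xy (φ-inj _ _ φa≡φx))
    onto d e | inj₂ (inj₂ (_ , _ , inj₂ (_ , inj₁ (φa≡φy , _)))) = ⊥-elim (proj₂ a∉xy (φ-inj _ _ φa≡φy))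
    onto d e | inj₂ (inj₂ (w , zw , inj₁ (_ , inj₂ (φa≡ψw , _)))) = ⊥-elim (disj a w (z-neighbour zw) φa≡ψw)
    onto d e | inj₂ (inj₂ (w , zw , inj₂ (_ , inj₂ (φa≡ψw , _)))) = ⊥-elim (disj a w (z-neighbour zw) φa≡ψw)

  ψ-edge : ∀ a b → a ≢ z → b ≢ z → Adj G₂ a b → Adj G (ψ a) (ψ b)
  ψ-edge a b a≢z b≢z ab = proj₂ (adj _ _) (inj₂ (inj₁ (a , b , a≢z , b≢z , refl , refl , ab)))

  half : Bool → Fin n
  half true  = φ x
  half false = φ y

  half≢ψ : ∀ s c → c ≢ z → half s ≢ ψ c
  half≢ψ true  c c≢z = disj x c c≢z
  half≢ψ false c c≢z = disj y c c≢z

  split-edge : ∀ b → Adj G₂ z b → Adj G (ψ b) (half (side b))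
  split-edge b zb with side b in sb
  ... | true  = proj₂ (adj _ _) (inj₂ (inj₂ (b , zb , inj₁ (sb , inj₂ (refl , refl)))))
  ... | false = proj₂ (adj _ _) (inj₂ (inj₂ (b , zb , inj₂ (sb , inj₂ (refl , refl)))))

  -- The neighbourhood of ψ b: ψ on vertices other than z, z ↦ its half.
  ψ-at : Fin n₂ → Fin n₂ → Fin n
  ψ-at b c with c ≟ z
  ... | yes _ = half (side b)
  ... | no  _ = ψ c

  ψ-at-z : ∀ b → ψ-at b z ≡ half (side b)
  ψ-at-z b with z ≟ z
  ... | yes _   = refl
  ... | no  z≢z = ⊥-elim (z≢z refl)

  ψ-at-other : ∀ b c → c ≢ z → ψ-at b c ≡ ψ c
  ψ-at-other b c c≢z with c ≟ z
  ... | yes c≡z = ⊥-elim (c≢z c≡z)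
  ... | no  _   = refl

  ψ-deg : ∀ b → b ≢ z → deg G (ψ b) ≡ deg G₂ b
  ψ-deg b b≢z = deg-bijection G₂ G b (ψ b) (ψ-at b) into injective onto
    where
    into : ∀ c → Adj G₂ b c → Adj G (ψ b) (ψ-at b c)
    into c bc with c ≟ z
    ... | no  c≢z  = ψ-edge b c b≢z c≢z bc
    ... | yes refl = split-edge b (adj-sym G₂ bc)
    injective : ∀ c c' → Adj G₂ b c → Adj G₂ b c' → ψ-at b c ≡ ψ-at b c' → c ≡ c'
    injective c c' _ _ e with c ≟ z | c' ≟ z
    ... | yes c≡z | yes c'≡z = trans c≡z (sym c'≡z)
    ... | yes _   | no c'≢z  = ⊥-elim (half≢ψ (side b) c' c'≢z e)
    ... | no c≢z  | yes _    = ⊥-elim (half≢ψ (side b) c c≢z (sym e))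
    ... | no c≢z  | no c'≢z  = ψ-inj c c' c≢z c'≢z e
    onto : ∀ d → Adj G (ψ b) d → ∃[ c ] (Adj G₂ b c × ψ-at b c ≡ d)
    onto d e with proj₁ (adj _ _) e
    ... | inj₁ (a , _ , φa≡ψb , _) = ⊥-elim (disj a b b≢z φa≡ψb)
    ... | inj₂ (inj₁ (a , c , a≢z , c≢z , ψa≡ψb , ψc≡d , ac)) with ψ-inj a b a≢z b≢z ψa≡ψb
    ... | refl = c , ac , trans (ψ-at-other b c c≢z) ψc≡d
    onto d e | inj₂ (inj₂ (_ , _ , inj₁ (_ , inj₁ (ψb≡φx , _)))) = ⊥-elim (disj x b b≢z (sym ψb≡φx))
    onto d e | inj₂ (inj₂ (_ , _ , inj₂ (_ , inj₁ (ψb≡φy , _)))) = ⊥-elim (disj y b b≢z (sym ψb≡φy))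
    onto d e | inj₂ (inj₂ (w , zw , inj₁ (sw , inj₂ (ψw≡ψb , d≡φx)))) with ψ-inj b w b≢z (z-neighbour zw) ψw≡ψb
    ... | refl = z , adj-sym G₂ zw , trans (ψ-at-z b) (trans (cong half sw) (sym d≡φx))
    onto d e | inj₂ (inj₂ (w , zw , inj₂ (sw , inj₂ (ψw≡ψb , d≡φy)))) with ψ-inj b w b≢z (z-neighbour zw) ψw≡ψb
    ... | refl = z , adj-sym G₂ zw , trans (ψ-at-z b) (trans (cong half sw) (sym d≡φy))

  embed₁ : GemEmbedding G₁ G (λ _ → ⊤) (Avoids x y)
  embed₁ = record { map = φ ; injective = λ c d _ _ → φ-inj c d
                  ; edges = λ c d _ _ cd core → φ-edge c d cd (avoids-not-pair core)
                  ; degrees = λ c _ → φ-deg c }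

  embed₂ : GemEmbedding G₂ G (λ c → c ≢ z) (λ _ → ⊤)
  embed₂ = record { map = ψ ; injective = ψ-inj
                  ; edges = λ c d c≢z d≢z cd _ → ψ-edge c d c≢z d≢z cd
                  ; degrees = λ c c≢z _ → ψ-deg c c≢z }

  -- An edge on the G₁ side is avoided by the gem from G₂, and an edge on the
  -- G₂ side by the core of the gem from G₁.
  edge-gems : Gem G₁ (λ _ → ⊤) (Avoids x y) → Gem G₂ (λ c → c ≢ z) (λ _ → ⊤) → EdgeGems G
  edge-gems gem₁ gem₂ u v uv with edge-sides uv
  ... | inj₁ (u₁ , v₁) = transport embed₂ (λ _ _ → tt)
    (λ c c≢z _ → separated FromG₁ (ψ-not-FromG₁ c c≢z) u₁
               , separated FromG₁ (ψ-not-FromG₁ c c≢z) v₁) gem₂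
  ... | inj₂ (u₂ , v₂) = transport embed₁ (λ _ _ → tt)
    (λ c _ c∉xy → separated FromG₂ (interior-not-FromG₂ c c∉xy) u₂
                , separated FromG₂ (interior-not-FromG₂ c c∉xy) v₂) gem₁

  -- A vertex on the G₁ side is avoided by the gem from G₂, and vice versa.
  vertex-gems : Gem G₁ (λ _ → ⊤) (Avoids x y) → Gem G₂ (λ c → c ≢ z) (λ _ → ⊤) → VertexGems G
  vertex-gems gem₁ gem₂ t with cover t
  ... | inj₁ (a , refl) =
    transport embed₂ (λ c c≢z → separated FromG₁ (ψ-not-FromG₁ c c≢z) (a , refl))
      (λ _ _ _ → tt) gem₂
  ... | inj₂ (b , b≢z , refl) =
    transport embed₁ (λ c _ → disj c b b≢z) (λ _ _ _ → tt) gem₁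

ore-gems : ∀ {k} {H : Graph k} → Is5Ore H → EdgeGems H × VertexGems H
ore-gems (K5 H refl complete) = edge-gems , vertex-gems
  where open CompleteGems H complete
ore-gems (ore {G₁ = G₁} {G₂ = G₂} h₁ h₂ O) = edge-gems gem₁ gem₂ , vertex-gems gem₁ gem₂
  where
  open OreComposition O
  open OreGems O
  gem₁ : Gem G₁ (λ _ → ⊤) (Avoids x y)
  gem₁ = proj₁ (ore-gems h₁) x y xy
  gem₂ : Gem G₂ (λ c → c ≢ z) (λ _ → ⊤)
  gem₂ = proj₂ (ore-gems h₂) z

module CollapsibleGems {n} {G : Graph n} {R : Subset n} (oc : OreCollapsible G R) where
  open OreCollapsible oc
  open InducedPlusEdge H-ind

  u∈R : u ∈ R
  u∈R = proj₁ (proj₂ (boundary u) (inj₁ refl))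

  v∈R : v ∈ R
  v∈R = proj₁ (proj₂ (boundary v) (inj₂ refl))

  u' v' : Fin k
  u' = proj₁ (proj₁ (ι-img u) u∈R)
  v' = proj₁ (proj₁ (ι-img v) v∈R)

  ι-u' : ι u' ≡ u
  ι-u' = proj₂ (proj₁ (ι-img u) u∈R)

  ι-v' : ι v' ≡ v
  ι-v' = proj₂ (proj₁ (ι-img v) v∈R)

  uv-edge : Adj H u' v'
  uv-edge = proj₂ (adj u' v') (inj₂ (inj₁ (ι-u' , ι-v')))

  ι-edge : ∀ c d → Adj H c d → ¬ IsPair u' v' c d → Adj G (ι c) (ι d)
  ι-edge c d cd ¬uv with proj₁ (adj c d) cd
  ... | inj₁ Gcd = Gcd
  ... | inj₂ (inj₁ (ιc≡u , ιd≡v)) =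
    ⊥-elim (¬uv (inj₁ (ι-inj _ _ (trans ιc≡u (sym ι-u')) , ι-inj _ _ (trans ιd≡v (sym ι-v')))))
  ... | inj₂ (inj₂ (ιc≡v , ιd≡u)) =
    ⊥-elim (¬uv (inj₂ (ι-inj _ _ (trans ιc≡v (sym ι-v')) , ι-inj _ _ (trans ιd≡u (sym ι-u')))))

  -- A vertex of R off the boundary has all its G-neighbours in R, so its
  -- degree in G equals its degree in H.
  ι-deg : ∀ c → Avoids u' v' c → deg G (ι c) ≡ deg H c
  ι-deg c c∉uv = deg-bijection H G c (ι c) ι
    (λ d cd → ι-edge c d cd (avoids-not-pair (inj₁ c∉uv))) (λ d d' _ _ → ι-inj d d') onto
    where
    onto : ∀ d → Adj G (ι c) d → ∃[ e ] (Adj H c e × ι e ≡ d)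
    onto d cd with d ∈? R
    ... | yes d∈R with proj₁ (ι-img d) d∈R
    ... | e , refl = e , proj₂ (adj c e) (inj₁ cd) , refl
    onto d cd | no d∉R with proj₁ (boundary (ι c)) (proj₂ (ι-img (ι c)) (c , refl) , d , d∉R , cd)
    ... | inj₁ ιc≡u = ⊥-elim (proj₁ c∉uv (ι-inj _ _ (trans ιc≡u (sym ι-u'))))
    ... | inj₂ ιc≡v = ⊥-elim (proj₂ c∉uv (ι-inj _ _ (trans ιc≡v (sym ι-v'))))

  embed : GemEmbedding H G (λ _ → ⊤) (Avoids u' v')
  embed = record { map = ι ; injective = λ c d _ _ → ι-inj c d
                 ; edges = λ c d _ _ cd core → ι-edge c d cd (avoids-not-pair core)
                 ; degrees = λ c _ → ι-deg c }

  ι-in-R : ∀ c → ι c ∈ R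
  ι-in-R c = proj₂ (ι-img (ι c)) (c , refl)

gem-inside : ∀ {n} {G : Graph n} {R : Subset n} {Q : Fin n → Set} →
  Gem G (_∈ R) Q → DiamondIn G R ⊎ EmeraldIn G R
gem-inside (diamond (D , in-R , _)) = inj₁ (D , in-R)
gem-inside (emerald (E , pq))       = inj₂ (E , λ i → proj₁ (pq i))

lemma2p6 : (n : ℕ) (G : Graph n) (R : Subset n) → OreCollapsible G R → DiamondIn G R ⊎ EmeraldIn G R
lemma2p6 n G R oc =
  gem-inside
    (transport embed (λ c _ → ι-in-R c) (λ _ _ _ → tt)
      (proj₁ (ore-gems H-ore) u' v' uv-edge))
  where
  open OreCollapsible oc using (H-ore)
  open CollapsibleGems oc
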